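{- Let $p$ be an odd prime, let $\alpha>1$ be an integer with $\gcd(\alpha,p)=1$, let $\gamma=\operatorname{ord}_p(\alpha)$, and let $n\in\mathbb{N}$. Then for all integers $s\ge0$ and $t\ge1$, $$S_p^n(s\gamma p^t)\le 2s\gamma\, t^{\,n-1}\left(\frac{p+1}{2}\right)^t .$$
   Context: A base-$p$ digit $d\in\{0,\dots,p-1\}$ is called large if $d>p/2$. For $a,n\in\mathbb{N}$, $S_p^n(a)=\#\{0\le s<a : \text{the base- }p\text{ representation of }\alpha^s\text{ contains fewer than }n\text{ large digits}\}$. -}

module Defs where

open import Data.Nat using (ℕ; zero; suc; _+_; _*_; _^_; _<_; _≤_; _<?_; NonZero)
open import Data.Nat.DivMod using (_/_; _%_)
open import Data.List using (List; []; _∷_; length; filter; upTo)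
open import Relation.Binary.PropositionalEquality using (_≡_)

-- Base-p digits of m, least significant first (m = 0 gives the empty list,
-- i.e. no large digits, matching the representation "0").
-- The fuel f = m suffices since m has at most m base-p digits for p ≥ 2.
digitsFuel : (p : ℕ) → ⦃ _ : NonZero p ⦄ → ℕ → ℕ → List ℕ
digitsFuel p zero    m       = []
digitsFuel p (suc f) zero    = []
digitsFuel p (suc f) (suc m) = (suc m % p) ∷ digitsFuel p f (suc m / p)

digits : (p : ℕ) → ⦃ _ : NonZero p ⦄ → ℕ → List ℕ
digits p m = digitsFuel p m m

-- number of large base-p digits of m: digits d with d > p/2, i.e. p < 2d
largeCount : (p : ℕ) → ⦃ _ : NonZero p ⦄ → ℕ → ℕ
largeCount p m = length (filter (λ d → p <? 2 * d) (digits p m))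

S : (p : ℕ) → ⦃ _ : NonZero p ⦄ → (α n a : ℕ) → ℕ
S p α n a = length (filter (λ s → largeCount p (α ^ s) <? n) (upTo a))

IsOrd : (p : ℕ) → ⦃ _ : NonZero p ⦄ → (α γ : ℕ) → Set
IsOrd p α γ =
  (0 < γ) × (α ^ γ % p ≡ 1 % p) × (∀ k → 0 < k → α ^ k % p ≡ 1 % p → γ ≤ k)
  where open import Data.Product using (_×_)

{-# OPTIONS --safe #-}
module Submission where

-- Write α ^ γ = 1 + p ^ (e + 1) · u with p ∤ u. The exponents lying in one residue class
-- mod γ and in one run of γ · p ^ t consecutive integers are x + d γ with d < p ^ t, and
-- α ^ (x + d γ) = α ^ x · (1 + p ^ (e + 1) · u) ^ d; lifting the exponent (p odd) shows that
-- the t base-p digits of these powers just above position e are pairwise distinct. So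
-- labelling x by its class, its run and this window of digits is injective, and a power
-- with fewer than n large digits has a window with fewer than n large digits: hence
-- S ≤ s γ N(t, n), where N(t, n) counts the strings of t digits with fewer than n large ones.
-- Of the p digits, (p + 1)/2 are small and (p − 1)/2 large, so
-- N(t + 1, n) ≤ (p + 1)/2 · (N(t, n) + N(t, n − 1)), which gives
-- N(t, n) ≤ ((p + 1)/2) ^ t · Σ_{j<n} (t choose j) ≤ 2 t ^ (n − 1) · ((p + 1)/2) ^ t.

open import Defs
open import Data.Bool using (Bool; true; false; not; _∧_; T)
open import Data.List using ([]; _∷_; _++_; [_]; length; filter; upTo)
open import Data.List.Properties using (upTo-∷ʳ; filter-++; length-++)
open import Data.Nat
open import Data.Nat.Combinatorics using (_C_; nC1≡n; nCk+nC[k+1]≡[n+1]C[k+1])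
open import Data.Nat.Coprimality using (Coprime)
open import Data.Nat.Divisibility
open import Data.Nat.DivMod
open import Data.Nat.Induction using (<-rec)
open import Data.Nat.Primality using (Prime; euclidsLemma; prime⇒nonZero; prime⇒nonTrivial)
open import Data.Nat.Properties
open import Algebra.Properties.CommutativeSemigroup +-commutativeSemigroup using (interchange)
open import Data.Nat.Tactic.RingSolver using (solve-∀)
open import Data.Product using (_×_; _,_; proj₁; proj₂; ∃-syntax; ∃₂)
open import Data.Sum using (inj₁; inj₂)
open import Function using (_∘_)
open import Relation.Binary.PropositionalEquality
  using (_≡_; _≢_; refl; sym; trans; cong; cong₂; subst; module ≡-Reasoning)
open import Relation.Nullary using (¬_; does; yes; no)
open import Relation.Nullary.Decidable using (dec-true; dec-false)
open import Relation.Nullary.Negation using (contradiction)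
open import Relation.Unary using (Pred; Decidable)

[m*n+o]%n≡o : ∀ m {n o} ⦃ _ : NonZero n ⦄ → o < n → (m * n + o) % n ≡ o
[m*n+o]%n≡o m {n} {o} o<n = trans (cong (_% n) (+-comm (m * n) o)) (trans ([m+kn]%n≡m%n o m n) (m<n⇒m%n≡m o<n))

[m*n+o]/n≡m : ∀ m {n o} ⦃ _ : NonZero n ⦄ → o < n → (m * n + o) / n ≡ m
[m*n+o]/n≡m m {n} {o} o<n = begin
  (m * n + o) / n       ≡⟨ +-distrib-/-∣ˡ o (n∣m*n m) ⟩
  m * n / n + o / n     ≡⟨ cong₂ _+_ (m*n/n≡m m n) (m<n⇒m/n≡0 o<n) ⟩
  m + 0                 ≡⟨ +-identityʳ m ⟩
  m                     ∎
  where open ≡-Reasoning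

[m+kn]/n≡m/n+k : ∀ m k n ⦃ _ : NonZero n ⦄ → (m + k * n) / n ≡ m / n + k
[m+kn]/n≡m/n+k m k n = trans (+-distrib-/-∣ʳ m (n∣m*n k)) (cong (m / n +_) (m*n/n≡m k n))

1<m⇒1<m^n : ∀ {m n} ⦃ _ : NonZero n ⦄ → 1 < m → 1 < m ^ n
1<m⇒1<m^n {m} {suc k} 1<m = <-≤-trans 1<m (m≤m*n m (m ^ k) ⦃ m^n≢0 m k ⦃ >-nonZero (<-trans z<s 1<m) ⦄ ⦄)

∣∧<⇒≡0 : ∀ {m n} → m ∣ n → n < m → n ≡ 0
∣∧<⇒≡0 {n = zero}  _   _   = refl
∣∧<⇒≡0 {n = suc _} m∣n n<m = contradiction m∣n (>⇒∤ n<m)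

[m+n]%o≡m%o⇒o∣n : ∀ m n {o} ⦃ _ : NonZero o ⦄ → (m + n) % o ≡ m % o → o ∣ n
[m+n]%o≡m%o⇒o∣n m n {o} eq = ∣m+n∣m⇒∣n (divides ((m + n) / o) (+-cancelˡ-≡ (m % o) _ _ (begin
  m % o + (m / o * o + n)    ≡⟨ +-assoc (m % o) _ n ⟨
  m % o + m / o * o + n      ≡⟨ cong (_+ n) (m≡m%n+[m/n]*n m o) ⟨
  m + n                      ≡⟨ m≡m%n+[m/n]*n (m + n) o ⟩
  (m + n) % o + (m + n) / o * o ≡⟨ cong (_+ (m + n) / o * o) eq ⟩
  m % o + (m + n) / o * o    ∎))) (n∣m*n (m / o))
  where open ≡-Reasoning

m<n⇒o<p⇒m*p+o<n*p : ∀ {m n o p} → m < n → o < p → m * p + o < n * p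
m<n⇒o<p⇒m*p+o<n*p {m} {n} {o} {p} m<n o<p = begin-strict
  m * p + o     <⟨ +-monoʳ-< (m * p) o<p ⟩
  m * p + p     ≡⟨ +-comm (m * p) p ⟩
  suc m * p     ≤⟨ *-monoˡ-≤ p m<n ⟩
  n * p         ∎
  where open ≤-Reasoning

*+-injective : ∀ {m m′ o o′ n} ⦃ _ : NonZero n ⦄ → o < n → o′ < n → m * n + o ≡ m′ * n + o′ → m ≡ m′ × o ≡ o′
*+-injective {m} {m′} o<n o′<n eq =
  trans (sym ([m*n+o]/n≡m m o<n)) (trans (cong (_/ _) eq) ([m*n+o]/n≡m m′ o′<n)) ,
  trans (sym ([m*n+o]%n≡o m o<n)) (trans (cong (_% _) eq) ([m*n+o]%n≡o m′ o′<n))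

%≡⇒≡+* : ∀ {m n} o ⦃ _ : NonZero o ⦄ → m ≤ n → m % o ≡ n % o → n ≡ m + (n / o ∸ m / o) * o
%≡⇒≡+* {m} {n} o m≤n m%o≡n%o = begin
  n                                         ≡⟨ m≡m%n+[m/n]*n n o ⟩
  n % o + n / o * o                         ≡⟨ cong₂ (λ r k → r + k * o) m%o≡n%o (m+[n∸m]≡n (/-monoˡ-≤ o m≤n)) ⟨
  m % o + (m / o + (n / o ∸ m / o)) * o     ≡⟨ regroup (m % o) (m / o) (n / o ∸ m / o) o ⟩
  (m % o + m / o * o) + (n / o ∸ m / o) * o ≡⟨ cong (_+ (n / o ∸ m / o) * o) (m≡m%n+[m/n]*n m o) ⟨
  m + (n / o ∸ m / o) * o                   ∎
  where
  open ≡-Reasoning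
  regroup : ∀ r k d o → r + (k + d) * o ≡ (r + k * o) + d * o
  regroup = solve-∀

/≡⇒∸< : ∀ {a b} M ⦃ _ : NonZero M ⦄ → a / M ≡ b / M → b ∸ a < M
/≡⇒∸< {a} {b} M a/M≡b/M = begin-strict
  b ∸ a                                         ≡⟨ cong₂ _∸_ (split b) (trans (split a) (cong (λ k → k * M + a % M) a/M≡b/M)) ⟩
  (b / M * M + b % M) ∸ (b / M * M + a % M)     ≡⟨ [m+n]∸[m+o]≡n∸o (b / M * M) (b % M) (a % M) ⟩
  b % M ∸ a % M                                 ≤⟨ m∸n≤m (b % M) (a % M) ⟩
  b % M                                         <⟨ m%n<n b M ⟩
  M                                             ∎
  where
  open ≤-Reasoning
  split : ∀ z → z ≡ z / M * M + z % M
  split z = trans (m≡m%n+[m/n]*n z M) (+-comm (z % M) _)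

suc<ᵇ : ∀ m n → (suc m <ᵇ n) ≡ (m <ᵇ n ∸ 1)
suc<ᵇ m zero    = refl
suc<ᵇ m (suc n) = refl

χ : Bool → ℕ
χ true  = 1
χ false = 0

∑< : ℕ → (ℕ → ℕ) → ℕ
∑< zero    f = 0
∑< (suc a) f = ∑< a f + f a

syntax ∑< a (λ x → e) = ∑[ x < a ] e

∑-cong : ∀ a {f g : ℕ → ℕ} → (∀ {x} → x < a → f x ≡ g x) → ∑< a f ≡ ∑< a g
∑-cong zero    f≗g = refl
∑-cong (suc a) f≗g = cong₂ _+_ (∑-cong a (f≗g ∘ m<n⇒m<1+n)) (f≗g ≤-refl)

∑-+ : ∀ a (f g : ℕ → ℕ) → ∑[ x < a ] (f x + g x) ≡ ∑< a f + ∑< a g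
∑-+ zero    f g = refl
∑-+ (suc a) f g = trans (cong (_+ (f a + g a)) (∑-+ a f g)) (interchange (∑< a f) (∑< a g) (f a) (g a))

∑-*ˡ : ∀ a c (f : ℕ → ℕ) → ∑[ x < a ] (c * f x) ≡ c * ∑< a f
∑-*ˡ zero    c f = sym (*-zeroʳ c)
∑-*ˡ (suc a) c f = trans (cong (_+ c * f a) (∑-*ˡ a c f)) (sym (*-distribˡ-+ c (∑< a f) (f a)))

∑-const : ∀ a c → ∑[ x < a ] c ≡ a * c
∑-const zero    c = refl
∑-const (suc a) c = trans (cong (_+ c) (∑-const a c)) (+-comm (a * c) c)

∑-++ : ∀ a b (f : ℕ → ℕ) → ∑< (a + b) f ≡ ∑< a f + ∑[ x < b ] f (a + x)
∑-++ a zero    f = trans (cong (λ c → ∑< c f) (+-identityʳ a)) (sym (+-identityʳ (∑< a f)))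
∑-++ a (suc b) f = begin
  ∑< (a + suc b) f                              ≡⟨ cong (λ c → ∑< c f) (+-suc a b) ⟩
  ∑< (a + b) f + f (a + b)                      ≡⟨ cong (_+ f (a + b)) (∑-++ a b f) ⟩
  ∑< a f + ∑[ x < b ] f (a + x) + f (a + b)     ≡⟨ +-assoc (∑< a f) _ _ ⟩
  ∑< a f + ∑[ x < suc b ] f (a + x)             ∎
  where open ≡-Reasoning

∑-blocks : ∀ k M (f : ℕ → ℕ) → ∑< (k * M) f ≡ ∑[ w < k ] ∑[ d < M ] f (w * M + d)
∑-blocks zero    M f = refl
∑-blocks (suc k) M f = begin
  ∑< (M + k * M) f                                      ≡⟨ cong (λ c → ∑< c f) (+-comm M (k * M)) ⟩
  ∑< (k * M + M) f                                      ≡⟨ ∑-++ (k * M) M f ⟩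
  ∑< (k * M) f + ∑[ d < M ] f (k * M + d)               ≡⟨ cong (_+ ∑[ d < M ] f (k * M + d)) (∑-blocks k M f) ⟩
  ∑[ w < suc k ] ∑[ d < M ] f (w * M + d)               ∎
  where open ≡-Reasoning

∑-periodic : ∀ k M ⦃ _ : NonZero M ⦄ (f : ℕ → ℕ) → ∑[ x < k * M ] f (x % M) ≡ k * ∑< M f
∑-periodic k M f = begin
  ∑[ x < k * M ] f (x % M)                          ≡⟨ ∑-blocks k M (f ∘ (_% M)) ⟩
  ∑[ w < k ] ∑[ d < M ] f ((w * M + d) % M)         ≡⟨ ∑-cong k (λ {w} _ → ∑-cong M (cong f ∘ [m*n+o]%n≡o w)) ⟩
  ∑[ w < k ] ∑< M f                                 ≡⟨ ∑-const k (∑< M f) ⟩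
  k * ∑< M f                                        ∎
  where open ≡-Reasoning

count : (ℕ → Bool) → ℕ → ℕ
count P a = ∑[ x < a ] χ (P x)

length-filter-∷ : ∀ {ℓ} {P : Pred ℕ ℓ} (P? : Decidable P) x xs →
  length (filter P? (x ∷ xs)) ≡ χ (does (P? x)) + length (filter P? xs)
length-filter-∷ P? x xs with does (P? x)
... | true  = refl
... | false = refl

length-filter-upTo : ∀ {ℓ} {P : Pred ℕ ℓ} (P? : Decidable P) a →
  length (filter P? (upTo a)) ≡ count (does ∘ P?) a
length-filter-upTo P? zero    = refl
length-filter-upTo P? (suc a) = begin
  length (filter P? (upTo (suc a)))                      ≡⟨ cong (length ∘ filter P?) (upTo-∷ʳ a) ⟨
  length (filter P? (upTo a ++ [ a ]))                   ≡⟨ cong length (filter-++ P? (upTo a) [ a ]) ⟩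
  length (filter P? (upTo a) ++ filter P? [ a ])         ≡⟨ length-++ (filter P? (upTo a)) ⟩
  length (filter P? (upTo a)) + length (filter P? [ a ]) ≡⟨ cong₂ _+_ (length-filter-upTo P? a) (length-filter-∷ P? a []) ⟩
  count (does ∘ P?) a + (χ (does (P? a)) + 0)            ≡⟨ cong (count (does ∘ P?) a +_) (+-identityʳ _) ⟩
  count (does ∘ P?) (suc a)                              ∎
  where open ≡-Reasoning

_─_ : (ℕ → Bool) → ℕ → ℕ → Bool
(Q ─ c) x = not (x ≡ᵇ c) ∧ Q x

─-self : ∀ Q c → (Q ─ c) c ≡ false
─-self Q c with c ≡ᵇ c | ≡⇒≡ᵇ c c refl
... | true | _ = refl

─-other : ∀ Q {c x} → x ≢ c → (Q ─ c) x ≡ Q x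
─-other Q {c} {x} x≢c with x ≡ᵇ c | ≡ᵇ⇒≡ x c
... | false | _   = refl
... | true  | x≡c = contradiction (x≡c _) x≢c

T⇒χ≡1 : ∀ {b} → T b → χ b ≡ 1
T⇒χ≡1 {true} _ = refl

count-─ : ∀ b (Q : ℕ → Bool) {c} → c < b → T (Q c) → count Q b ≡ suc (count (Q ─ c) b)
count-─ (suc b) Q {c} c<1+b Qc with c ≟ b
... | yes refl = begin
  count Q c + χ (Q c)                    ≡⟨ cong₂ _+_ (∑-cong c (λ x<c → cong χ (sym (─-other Q (<⇒≢ x<c))))) (T⇒χ≡1 Qc) ⟩
  count (Q ─ c) c + 1                    ≡⟨ +-comm _ 1 ⟩
  suc (count (Q ─ c) c)                  ≡⟨ cong suc (+-identityʳ _) ⟨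
  suc (count (Q ─ c) c + 0)              ≡⟨ cong (λ z → suc (count (Q ─ c) c + χ z)) (─-self Q c) ⟨
  suc (count (Q ─ c) (suc c))            ∎
  where open ≡-Reasoning
... | no c≢b = begin
  count Q b + χ (Q b)                    ≡⟨ cong₂ _+_ (count-─ b Q (≤∧≢⇒< (≤-pred c<1+b) c≢b) Qc)
                                                      (cong χ (sym (─-other Q (c≢b ∘ sym)))) ⟩
  suc (count (Q ─ c) b) + χ ((Q ─ c) b)  ∎
  where open ≡-Reasoning

count-injection : ∀ a {b} (P Q : ℕ → Bool) (f : ℕ → ℕ) →
  (∀ {x} → x < a → T (P x) → f x < b × T (Q (f x))) →
  (∀ {x y} → x < y → y < a → T (P x) → T (P y) → f x ≢ f y) →
  count P a ≤ count Q b
count-injection zero    P Q f maps inj = z≤n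
count-injection (suc a) {b} P Q f maps inj with P a in Pa
... | false = subst (_≤ count Q b) (sym (+-identityʳ (count P a)))
                (count-injection a P Q f (maps ∘ m<n⇒m<1+n) (λ x<y y<a → inj x<y (m<n⇒m<1+n y<a)))
... | true = begin
  count P a + 1                  ≤⟨ +-monoˡ-≤ 1 (count-injection a P (Q ─ f a) f maps′ inj′) ⟩
  count (Q ─ f a) b + 1          ≡⟨ +-comm _ 1 ⟩
  suc (count (Q ─ f a) b)        ≡⟨ count-─ b Q fa<b Qfa ⟨
  count Q b                      ∎
  where
  open ≤-Reasoning
  T-Pa : T (P a)
  T-Pa = subst T (sym Pa) _
  fa<b : f a < b
  fa<b = proj₁ (maps ≤-refl T-Pa)
  Qfa : T (Q (f a))
  Qfa = proj₂ (maps ≤-refl T-Pa)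
  inj′ : ∀ {x y} → x < y → y < a → T (P x) → T (P y) → f x ≢ f y
  inj′ x<y y<a = inj x<y (m<n⇒m<1+n y<a)
  maps′ : ∀ {x} → x < a → T (P x) → f x < b × T ((Q ─ f a) (f x))
  maps′ {x} x<a Px = proj₁ (maps (m<n⇒m<1+n x<a) Px) ,
    subst T (sym (─-other Q (inj x<a ≤-refl Px T-Pa))) (proj₂ (maps (m<n⇒m<1+n x<a) Px))

[1+n]C2≡n+nC2 : ∀ n → suc n C 2 ≡ n + n C 2
[1+n]C2≡n+nC2 n = trans (sym (nCk+nC[k+1]≡[n+1]C[k+1] n 1)) (cong (_+ n C 2) (nC1≡n n))

[1+2q]C2≡[1+2q]*q : ∀ q → (1 + 2 * q) C 2 ≡ (1 + 2 * q) * q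
[1+2q]C2≡[1+2q]*q zero    = refl
[1+2q]C2≡[1+2q]*q (suc q) = begin
  (1 + 2 * suc q) C 2                    ≡⟨ cong (λ m → suc m C 2) (*-suc 2 q) ⟩
  (2 + r) C 2                            ≡⟨ [1+n]C2≡n+nC2 (1 + r) ⟩
  (1 + r) + (1 + r) C 2                  ≡⟨ cong ((1 + r) +_) ([1+n]C2≡n+nC2 r) ⟩
  (1 + r) + (r + r C 2)                  ≡⟨ cong (λ c → (1 + r) + (r + c)) ([1+2q]C2≡[1+2q]*q q) ⟩
  (1 + r) + (r + r * q)                  ≡⟨ regroup q ⟩
  (1 + 2 * suc q) * suc q                ∎
  where
  open ≡-Reasoning
  r : ℕ
  r = 1 + 2 * q
  regroup : ∀ q → (2 + 2 * q) + ((1 + 2 * q) + (1 + 2 * q) * q) ≡ (1 + 2 * (1 + q)) * (1 + q)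
  regroup = solve-∀

binomial₂ : ∀ a k → ∃[ c ] (1 + a) ^ k ≡ 1 + k * a + (k C 2) * (a * a) + a * a * a * c
binomial₂ a zero    = 0 , cong suc (sym (*-zeroʳ (a * a * a)))
binomial₂ a (suc k) with binomial₂ a k
... | c , eq = c′ , (begin
  (1 + a) * (1 + a) ^ k                                                 ≡⟨ cong ((1 + a) *_) eq ⟩
  (1 + a) * (1 + k * a + (k C 2) * (a * a) + a * a * a * c)             ≡⟨ step a k (k C 2) c ⟩
  1 + suc k * a + (k + k C 2) * (a * a) + a * a * a * c′                ≡⟨ cong (λ T → 1 + suc k * a + T * (a * a) + a * a * a * c′)
                                                                             ([1+n]C2≡n+nC2 k) ⟨
  1 + suc k * a + (suc k C 2) * (a * a) + a * a * a * c′                ∎)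
  where
  open ≡-Reasoning
  c′ : ℕ
  c′ = c + k C 2 + a * c
  step : ∀ a k T c → (1 + a) * (1 + k * a + T * (a * a) + a * a * a * c)
                   ≡ 1 + (1 + k) * a + (k + T) * (a * a) + a * a * a * (c + T + a * c)
  step = solve-∀

1+*-^ : ∀ a b d → ∃[ w ] (1 + a * b) ^ d ≡ 1 + a * w
1+*-^ a b zero    = 0 , cong suc (sym (*-zeroʳ a))
1+*-^ a b (suc d) with 1+*-^ a b d
... | w , eq = b + w + a * b * w , trans (cong ((1 + a * b) *_) eq) (expand a b w)
  where
  expand : ∀ a b w → (1 + a * b) * (1 + a * w) ≡ 1 + a * (b + w + a * b * w)
  expand = solve-∀

module _ {p : ℕ} (prime : Prime p) where

  private instance
    p≢0 : NonZero p
    p≢0 = prime⇒nonZero prime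
    p-nonTrivial : NonTrivial p
    p-nonTrivial = prime⇒nonTrivial prime

  ∤-^ : ∀ {a} k → ¬ p ∣ a → ¬ p ∣ a ^ k
  ∤-^ zero    _   p∣1 = nonTrivial⇒≢1 (∣1⇒≡1 p∣1)
  ∤-^ {a} (suc k) p∤a p∣a^[1+k] with euclidsLemma a (a ^ k) prime p∣a^[1+k]
  ... | inj₁ p∣a   = p∤a p∣a
  ... | inj₂ p∣a^k = ∤-^ k p∤a p∣a^k

  ^∣-cancelˡ : ∀ t {a w} → ¬ p ∣ a → p ^ t ∣ a * w → p ^ t ∣ w
  ^∣-cancelˡ zero    _ _ = 1∣ _
  ^∣-cancelˡ (suc t) {a} {w} p∤a p^[1+t]∣aw with euclidsLemma a w prime (∣-trans (m∣m*n (p ^ t)) p^[1+t]∣aw)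
  ... | inj₁ p∣a = contradiction p∣a p∤a
  ... | inj₂ (divides w′ refl) = subst (_∣ w′ * p) (*-comm (p ^ t) p) (*-monoˡ-∣ p (^∣-cancelˡ t p∤a p^t∣aw′))
    where
    reorder : ∀ a w′ p → a * (w′ * p) ≡ p * (a * w′)
    reorder = solve-∀
    p^t∣aw′ : p ^ t ∣ a * w′
    p^t∣aw′ = *-cancelˡ-∣ p (subst (p ^ suc t ∣_) (reorder a w′ p) p^[1+t]∣aw)

  p^f*u*p≡p^[1+f]*u : ∀ f u → p ^ f * u * p ≡ p ^ suc f * u
  p^f*u*p≡p^[1+f]*u f u = trans (*-comm (p ^ f * u) p) (sym (*-assoc p (p ^ f) u))

  p-adic-decomposition : ∀ x → 0 < x → ∃₂ λ f u → x ≡ p ^ f * u × ¬ p ∣ u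
  p-adic-decomposition = <-rec _ go
    where
    Decomposition : ℕ → Set
    Decomposition x = ∃₂ λ f u → x ≡ p ^ f * u × ¬ p ∣ u
    go : ∀ x → (∀ {y} → y < x → 0 < y → Decomposition y) → 0 < x → Decomposition x
    go x rec 0<x with p ∣? x
    ... | no p∤x = 0 , x , sym (*-identityˡ x) , p∤x
    ... | yes (divides (suc y) refl) with rec (m<m*n (suc y) p (nonTrivial⇒n>1 p)) z<s
    ...   | f , u , y≡ , p∤u = suc f , u , trans (cong (_* p) y≡) (p^f*u*p≡p^[1+f]*u f u) , p∤u

  %p≡1⇒≡1+p^[1+e]*u : ∀ {β} → 1 < β → β % p ≡ 1 → ∃₂ λ e u → β ≡ 1 + p ^ suc e * u × ¬ p ∣ u
  %p≡1⇒≡1+p^[1+e]*u {β} 1<β β%p≡1 =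
    let e , u , β/p≡ , p∤u = p-adic-decomposition (β / p) 0<β/p
    in e , u , trans β≡1+[β/p]*p (trans (cong (λ k → 1 + k * p) β/p≡) (cong suc (p^f*u*p≡p^[1+f]*u e u))) , p∤u
    where
    β≡1+[β/p]*p : β ≡ 1 + β / p * p
    β≡1+[β/p]*p = trans (m≡m%n+[m/n]*n β p) (cong (_+ β / p * p) β%p≡1)
    0<β/p : 0 < β / p
    0<β/p = n≢0⇒n>0 (λ β/p≡0 → <⇒≢ 1<β (sym (trans β≡1+[β/p]*p (cong (λ k → 1 + k * p) β/p≡0))))

  valuation-^-coprime : ∀ e {u d} → ¬ p ∣ u → ¬ p ∣ d → ∃[ v ] (1 + p ^ suc e * u) ^ d ≡ 1 + p ^ suc e * v × ¬ p ∣ v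
  valuation-^-coprime e {u} {d} p∤u p∤d with binomial₂ (p ^ suc e * u) d
  ... | c , eq = v , trans eq (regroup E u d (d C 2) c) , p∤v
    where
    E v : ℕ
    E = p ^ suc e
    v = d * u + E * (u * u * (d C 2 + E * u * c))
    regroup : ∀ E u d T c → 1 + d * (E * u) + T * ((E * u) * (E * u)) + (E * u) * (E * u) * (E * u) * c
                          ≡ 1 + E * (d * u + E * (u * u * (T + E * u * c)))
    regroup = solve-∀
    p∤v : ¬ p ∣ v
    p∤v p∣v with euclidsLemma d u prime (∣m+n∣m⇒∣n (subst (p ∣_) (+-comm (d * u) _) p∣v) (∣m⇒∣m*n _ (m∣m*n (p ^ e))))
    ... | inj₁ p∣d = p∤d p∣d
    ... | inj₂ p∣u = p∤u p∣u

  -- Needs p ∣ p C 2, i.e. p odd: for p = 2, (1 + 2 u) ^ 2 − 1 = 4 u (u + 1) is divisible by 8.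
  valuation-^-p : p ∣ p C 2 → ∀ e {u} → ¬ p ∣ u → ∃[ v ] (1 + p ^ suc e * u) ^ p ≡ 1 + p ^ suc (suc e) * v × ¬ p ∣ v
  valuation-^-p (divides r pC2≡rp) e {u} p∤u with binomial₂ (p ^ suc e * u) p
  ... | c , eq = v , trans eq (trans (cong (λ T → 1 + p * (E * u) + T * ((E * u) * (E * u)) + (E * u) * (E * u) * (E * u) * c) pC2≡rp)
                                     (regroup p X u r c)) , p∤v
    where
    X E v : ℕ
    X = p ^ e
    E = p ^ suc e
    v = u + p * (r * X * u * u + X * X * u * u * u * c)
    regroup : ∀ p X u r c → 1 + p * (p * X * u) + r * p * ((p * X * u) * (p * X * u)) + (p * X * u) * (p * X * u) * (p * X * u) * c
                          ≡ 1 + p * (p * X) * (u + p * (r * X * u * u + X * X * u * u * u * c))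
    regroup = solve-∀
    p∤v : ¬ p ∣ v
    p∤v p∣v = p∤u (∣m+n∣m⇒∣n (subst (p ∣_) (+-comm u _) p∣v) (m∣m*n _))

  lifting-the-exponent : p ∣ p C 2 → ∀ t {e u d w} → ¬ p ∣ u →
    (1 + p ^ suc e * u) ^ d ≡ 1 + p ^ (suc e + t) * w → p ^ t ∣ d
  lifting-the-exponent _ zero _ _ = 1∣ _
  lifting-the-exponent p∣pC2 (suc t) {e} {u} {d} {w} p∤u eq with p ∣? d
  ... | no p∤d with valuation-^-coprime e p∤u p∤d
  ...   | v , eqv , p∤v = contradiction (subst (p ∣_) (sym v≡) (∣m⇒∣m*n w (m∣m*n (p ^ t)))) p∤v
    where
    E : ℕ
    E = p ^ suc e
    v≡ : v ≡ p ^ suc t * w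
    v≡ = *-cancelˡ-≡ v _ E ⦃ m^n≢0 p (suc e) ⦄ (begin
      E * v                     ≡⟨ suc-injective (trans (sym eqv) eq) ⟩
      p ^ (suc e + suc t) * w   ≡⟨ cong (_* w) (^-distribˡ-+-* p (suc e) (suc t)) ⟩
      E * p ^ suc t * w         ≡⟨ *-assoc E _ w ⟩
      E * (p ^ suc t * w)       ∎)
      where open ≡-Reasoning
  lifting-the-exponent p∣pC2 (suc t) {e} {u} {w = w} p∤u eq | yes (divides d′ refl) with valuation-^-p p∣pC2 e p∤u
  ... | v , eqv , p∤v = subst (_∣ d′ * p) (*-comm (p ^ t) p) (*-monoˡ-∣ p (lifting-the-exponent p∣pC2 t {suc e} {v} {d′} p∤v eq′))
    where
    β : ℕ
    β = 1 + p ^ suc e * u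
    eq′ : (1 + p ^ suc (suc e) * v) ^ d′ ≡ 1 + p ^ (suc (suc e) + t) * w
    eq′ = begin
      (1 + p ^ suc (suc e) * v) ^ d′     ≡⟨ cong (_^ d′) eqv ⟨
      (β ^ p) ^ d′                       ≡⟨ ^-*-assoc β p d′ ⟩
      β ^ (p * d′)                       ≡⟨ cong (β ^_) (*-comm p d′) ⟩
      β ^ (d′ * p)                       ≡⟨ eq ⟩
      1 + p ^ (suc e + suc t) * w        ≡⟨ cong (λ k → 1 + p ^ k * w) (+-suc (suc e) t) ⟩
      1 + p ^ (suc (suc e) + t) * w      ∎
      where open ≡-Reasoning

module _ (p : ℕ) ⦃ _ : NonZero p ⦄ where

  large : ℕ → Bool
  large d = p <ᵇ 2 * d

  lowLarge : ℕ → ℕ → ℕ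
  lowLarge zero    v = 0
  lowLarge (suc t) v = χ (large (v % p)) + lowLarge t (v / p)

  lowLarge-0 : ∀ t → lowLarge t 0 ≡ 0
  lowLarge-0 zero    = refl
  lowLarge-0 (suc t) = cong₂ (λ d w → χ (large d) + w) (m<n⇒m%n≡m (>-nonZero⁻¹ p)) (trans (cong (lowLarge t) (0/n≡0 p)) (lowLarge-0 t))

  lowLarge-*+ : ∀ t w {d} → d < p → lowLarge (suc t) (w * p + d) ≡ χ (large d) + lowLarge t w
  lowLarge-*+ t w d<p = cong₂ (λ d w → χ (large d) + lowLarge t w) ([m*n+o]%n≡o w d<p) ([m*n+o]/n≡m w d<p)

  lowLarge-% : ∀ t v → lowLarge t ((v % p ^ t) ⦃ m^n≢0 p t ⦄) ≡ lowLarge t v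
  lowLarge-% zero    v = refl
  lowLarge-% (suc t) v =
    cong₂ (λ d w → χ (large d) + w) lowest-digit (trans (cong (lowLarge t) higher-digits) (lowLarge-% t (v / p)))
    where
    instance _ = m^n≢0 p t ; _ = m^n≢0 p (suc t) ; _ = m*n≢0 (p ^ t) p
    lowest-digit : v % p ^ suc t % p ≡ v % p
    lowest-digit = m∣n⇒o%n%m≡o%m p (p ^ suc t) v (m∣m*n (p ^ t))
    higher-digits : v % p ^ suc t / p ≡ v / p % p ^ t
    higher-digits = trans (cong (_/ p) (%-congʳ (*-comm p (p ^ t)))) (m%[n*o]/o≡m/o%n v (p ^ t) p)

  lowLarge-/ : ∀ e t m → lowLarge t ((m / p ^ e) ⦃ m^n≢0 p e ⦄) ≤ lowLarge (e + t) m
  lowLarge-/ zero    t m = ≤-reflexive (cong (lowLarge t) (n/1≡n m))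
  lowLarge-/ (suc e) t m = begin
    lowLarge t (m / (p * p ^ e))       ≡⟨ cong (lowLarge t) (m/n/o≡m/[n*o] m p (p ^ e)) ⟨
    lowLarge t (m / p / p ^ e)         ≤⟨ lowLarge-/ e t (m / p) ⟩
    lowLarge (e + t) (m / p)           ≤⟨ m≤n+m _ _ ⟩
    lowLarge (suc e + t) m             ∎
    where
    open ≤-Reasoning
    instance _ = m^n≢0 p e ; _ = m^n≢0 p (suc e)

  lowLarge≤largeCount : 1 < p → ∀ t m → lowLarge t m ≤ largeCount p m
  lowLarge≤largeCount 1<p t m = lowLarge≤largeFuel t ≤-refl
    where
    lowLarge≤largeFuel : ∀ t {f m} → m ≤ f → lowLarge t m ≤ length (filter (λ d → p <? 2 * d) (digitsFuel p f m))
    lowLarge≤largeFuel zero    _ = z≤n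
    lowLarge≤largeFuel (suc t) {m = zero} _ = ≤-trans (≤-reflexive (lowLarge-0 (suc t))) z≤n
    lowLarge≤largeFuel (suc t) {suc f} {suc m} (s≤s m≤f) =
      subst (lowLarge (suc t) (suc m) ≤_) (sym (length-filter-∷ (λ d → p <? 2 * d) (suc m % p) (digitsFuel p f (suc m / p))))
        (+-monoʳ-≤ _ (lowLarge≤largeFuel t (≤-trans (≤-pred (m/n<m (suc m) p 1<p)) m≤f)))

-- binomSum t n = Σ_{j<n} (t choose j), by Pascal's rule.
binomSum : ℕ → ℕ → ℕ
binomSum zero    n = χ (0 <ᵇ n)
binomSum (suc t) n = binomSum t n + binomSum t (n ∸ 1)

binomSum-0 : ∀ t → binomSum t 0 ≡ 0
binomSum-0 zero    = refl
binomSum-0 (suc t) = cong₂ _+_ (binomSum-0 t) (binomSum-0 t)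

binomSum-1 : ∀ t → binomSum t 1 ≡ 1
binomSum-1 zero    = refl
binomSum-1 (suc t) = cong₂ _+_ (binomSum-1 t) (binomSum-0 t)

binomSum≤ : ∀ t n → binomSum (suc t) n ≤ 2 * suc t ^ (n ∸ 1)
binomSum≤ t zero = ≤-trans (≤-reflexive (binomSum-0 (suc t))) z≤n
binomSum≤ t (suc zero) = ≤-trans (≤-reflexive (binomSum-1 (suc t))) (s≤s z≤n)
binomSum≤ zero (suc (suc m)) = ≤-reflexive (sym (cong (2 *_) (^-zeroˡ (suc m))))
binomSum≤ (suc t) (suc (suc m)) = begin
  binomSum (suc t) (2 + m) + binomSum (suc t) (1 + m) ≤⟨ +-mono-≤ (binomSum≤ t (2 + m)) (binomSum≤ t (1 + m)) ⟩
  2 * suc t ^ (1 + m) + 2 * suc t ^ m                 ≡⟨ regroup t (suc t ^ m) ⟩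
  2 * (2 + t) * suc t ^ m                             ≤⟨ *-monoʳ-≤ (2 * (2 + t)) (^-monoˡ-≤ m (n≤1+n (suc t))) ⟩
  2 * (2 + t) * (2 + t) ^ m                           ≡⟨ *-assoc 2 (2 + t) ((2 + t) ^ m) ⟩
  2 * (2 + t) ^ (1 + m)                               ∎
  where
  open ≤-Reasoning
  regroup : ∀ t x → 2 * ((1 + t) * x) + 2 * x ≡ 2 * (2 + t) * x
  regroup = solve-∀

module _ (q : ℕ) where

  private
    p : ℕ
    p = 1 + 2 * q

  fewLarge : ℕ → ℕ → ℕ
  fewLarge t n = count (λ v → lowLarge p t v <ᵇ n) (p ^ t)

  large-≤q : ∀ {d} → d ≤ q → large p d ≡ false
  large-≤q {d} d≤q = dec-false (p <? 2 * d) (≤⇒≯ (≤-trans (*-monoʳ-≤ 2 d≤q) (n≤1+n (2 * q))))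

  large->q : ∀ c → large p (suc q + c) ≡ true
  large->q c = dec-true (p <? 2 * (suc q + c)) (≤-trans (≤-reflexive (sym (*-suc 2 q))) (*-monoʳ-≤ 2 (m≤m+n (suc q) c)))

  ∑-digits-large : ∀ L n → ∑[ d < p ] χ (χ (large p d) + L <ᵇ n) ≡ suc q * χ (L <ᵇ n) + q * χ (L <ᵇ n ∸ 1)
  ∑-digits-large L n = begin
    ∑< p g                                                   ≡⟨ cong (λ a → ∑< a g) p≡suc[q]+q ⟩
    ∑< (suc q + q) g                                         ≡⟨ ∑-++ (suc q) q g ⟩
    ∑< (suc q) g + ∑[ c < q ] g (suc q + c)                  ≡⟨ cong₂ _+_ (∑-cong (suc q) small-digit) (∑-cong q large-digit) ⟩
    ∑[ d < suc q ] χ (L <ᵇ n) + ∑[ c < q ] χ (L <ᵇ n ∸ 1)   ≡⟨ cong₂ _+_ (∑-const (suc q) _) (∑-const q _) ⟩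
    suc q * χ (L <ᵇ n) + q * χ (L <ᵇ n ∸ 1)                  ∎
    where
    open ≡-Reasoning
    g : ℕ → ℕ
    g d = χ (χ (large p d) + L <ᵇ n)
    p≡suc[q]+q : p ≡ suc q + q
    p≡suc[q]+q = cong (suc ∘ (q +_)) (+-identityʳ q)
    small-digit : ∀ {d} → d < suc q → g d ≡ χ (L <ᵇ n)
    small-digit d<1+q = cong (λ b → χ (χ b + L <ᵇ n)) (large-≤q (≤-pred d<1+q))
    large-digit : ∀ {c} → c < q → g (suc q + c) ≡ χ (L <ᵇ n ∸ 1)
    large-digit {c} _ = trans (cong (λ b → χ (χ b + L <ᵇ n)) (large->q c)) (cong χ (suc<ᵇ L n))

  fewLarge-suc : ∀ t n → fewLarge (suc t) n ≡ suc q * fewLarge t n + q * fewLarge t (n ∸ 1)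
  fewLarge-suc t n = begin
    count F (p * p ^ t)                                                   ≡⟨ cong (count F) (*-comm p (p ^ t)) ⟩
    ∑[ v < p ^ t * p ] χ (F v)                                            ≡⟨ ∑-blocks (p ^ t) p (χ ∘ F) ⟩
    ∑[ w < p ^ t ] ∑[ d < p ] χ (F (w * p + d))                           ≡⟨ ∑-cong (p ^ t) (λ {w} _ → ∑-cong p (λ d<p →
                                                                               cong (λ k → χ (k <ᵇ n)) (lowLarge-*+ p t w d<p))) ⟩
    ∑[ w < p ^ t ] ∑[ d < p ] χ (χ (large p d) + lowLarge p t w <ᵇ n)     ≡⟨ ∑-cong (p ^ t) (λ {w} _ → ∑-digits-large (lowLarge p t w) n) ⟩
    ∑[ w < p ^ t ] (suc q * χ (A w) + q * χ (B w))                        ≡⟨ ∑-+ (p ^ t) _ _ ⟩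
    ∑[ w < p ^ t ] (suc q * χ (A w)) + ∑[ w < p ^ t ] (q * χ (B w))       ≡⟨ cong₂ _+_ (∑-*ˡ (p ^ t) (suc q) _) (∑-*ˡ (p ^ t) q _) ⟩
    suc q * fewLarge t n + q * fewLarge t (n ∸ 1)                         ∎
    where
    open ≡-Reasoning
    F A B : ℕ → Bool
    F v = lowLarge p (suc t) v <ᵇ n
    A w = lowLarge p t w <ᵇ n
    B w = lowLarge p t w <ᵇ n ∸ 1

  fewLarge≤ : ∀ t n → fewLarge t n ≤ suc q ^ t * binomSum t n
  fewLarge≤ zero    n = m≤m+n _ 0
  fewLarge≤ (suc t) n = begin
    fewLarge (suc t) n                                            ≡⟨ fewLarge-suc t n ⟩
    suc q * fewLarge t n + q * fewLarge t (n ∸ 1)                 ≤⟨ +-monoʳ-≤ (suc q * fewLarge t n) (*-monoˡ-≤ _ (n≤1+n q)) ⟩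
    suc q * fewLarge t n + suc q * fewLarge t (n ∸ 1)             ≡⟨ *-distribˡ-+ (suc q) (fewLarge t n) (fewLarge t (n ∸ 1)) ⟨
    suc q * (fewLarge t n + fewLarge t (n ∸ 1))                   ≤⟨ *-monoʳ-≤ (suc q) (+-mono-≤ (fewLarge≤ t n) (fewLarge≤ t (n ∸ 1))) ⟩
    suc q * (l^t * binomSum t n + l^t * binomSum t (n ∸ 1))       ≡⟨ cong (suc q *_) (*-distribˡ-+ l^t (binomSum t n) (binomSum t (n ∸ 1))) ⟨
    suc q * (l^t * binomSum (suc t) n)                            ≡⟨ *-assoc (suc q) l^t _ ⟨
    suc q ^ suc t * binomSum (suc t) n                            ∎
    where
    open ≤-Reasoning
    l^t : ℕ
    l^t = suc q ^ t

module _ {q : ℕ} (prime : Prime (1 + 2 * q)) where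

  private
    p : ℕ
    p = 1 + 2 * q

  module _ {α γ e u : ℕ} ⦃ _ : NonZero γ ⦄ (p∤α : ¬ p ∣ α) (p∤u : ¬ p ∣ u)
           (αᵞ≡ : α ^ γ ≡ 1 + p ^ suc e * u) (t : ℕ) where

    private
      E M : ℕ
      E = p ^ suc e
      M = p ^ t
      instance
        E≢0 : NonZero E
        E≢0 = m^n≢0 p (suc e)
        M≢0 : NonZero M
        M≢0 = m^n≢0 p t

    window : ℕ → ℕ
    window x = α ^ x / E % M

    window-injective : ∀ x {d} → d < M → window (x + d * γ) ≡ window x → d ≡ 0
    window-injective x {d} d<M same-window with 1+*-^ E u d
    ... | w , βᵈ≡ = ∣∧<⇒≡0 (lifting-the-exponent prime p∣pC2 t {e} p∤u βᵈ≡′) d<M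
      where
      p∣pC2 : p ∣ p C 2
      p∣pC2 = divides q (trans ([1+2q]C2≡[1+2q]*q q) (*-comm p q))
      αˣ⁺ᵈᵞ≡ : α ^ (x + d * γ) ≡ α ^ x + α ^ x * w * E
      αˣ⁺ᵈᵞ≡ = begin
        α ^ (x + d * γ)              ≡⟨ ^-distribˡ-+-* α x (d * γ) ⟩
        α ^ x * α ^ (d * γ)          ≡⟨ cong (λ k → α ^ x * α ^ k) (*-comm d γ) ⟩
        α ^ x * α ^ (γ * d)          ≡⟨ cong (α ^ x *_) (^-*-assoc α γ d) ⟨
        α ^ x * (α ^ γ) ^ d          ≡⟨ cong (λ β → α ^ x * β ^ d) αᵞ≡ ⟩
        α ^ x * (1 + E * u) ^ d      ≡⟨ cong (α ^ x *_) βᵈ≡ ⟩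
        α ^ x * (1 + E * w)          ≡⟨ expand (α ^ x) E w ⟩
        α ^ x + α ^ x * w * E        ∎
        where
        open ≡-Reasoning
        expand : ∀ a E w → a * (1 + E * w) ≡ a + a * w * E
        expand = solve-∀
      M∣αˣw : M ∣ α ^ x * w
      M∣αˣw = [m+n]%o≡m%o⇒o∣n (α ^ x / E) (α ^ x * w) (begin
        (α ^ x / E + α ^ x * w) % M              ≡⟨ cong (_% M) ([m+kn]/n≡m/n+k (α ^ x) (α ^ x * w) E) ⟨
        (α ^ x + α ^ x * w * E) / E % M          ≡⟨ cong (λ k → k / E % M) αˣ⁺ᵈᵞ≡ ⟨
        window (x + d * γ)                       ≡⟨ same-window ⟩
        window x                                 ∎)
        where open ≡-Reasoning
      M∣w : M ∣ w
      M∣w = ^∣-cancelˡ prime t (∤-^ prime x p∤α) M∣αˣw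
      βᵈ≡′ : (1 + E * u) ^ d ≡ 1 + p ^ (suc e + t) * quotient M∣w
      βᵈ≡′ = begin
        (1 + E * u) ^ d                       ≡⟨ βᵈ≡ ⟩
        1 + E * w                             ≡⟨ cong (λ k → 1 + E * k) (_∣_.equality M∣w) ⟩
        1 + E * (quotient M∣w * M)            ≡⟨ cong suc (regroup E (quotient M∣w) M) ⟩
        1 + E * M * quotient M∣w              ≡⟨ cong (λ k → 1 + k * quotient M∣w) (^-distribˡ-+-* p (suc e) t) ⟨
        1 + p ^ (suc e + t) * quotient M∣w    ∎
        where
        open ≡-Reasoning
        regroup : ∀ E k M → E * (k * M) ≡ E * M * k
        regroup = solve-∀

    orbit : ℕ → ℕ
    orbit x = x / γ / M * γ + x % γ

    label : ℕ → ℕ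
    label x = orbit x * M + window x

    label-injective : ∀ {x y} → x ≤ y → label x ≡ label y → x ≡ y
    label-injective {x} {y} x≤y same-label with *+-injective (m%n<n _ M) (m%n<n _ M) same-label
    ... | same-orbit , same-window with *+-injective (m%n<n x γ) (m%n<n y γ) same-orbit
    ...   | same-run , same-residue = sym (begin
      y               ≡⟨ y≡x+dγ ⟩
      x + d * γ       ≡⟨ cong (λ k → x + k * γ) d≡0 ⟩
      x + 0           ≡⟨ +-identityʳ x ⟩
      x               ∎)
      where
      open ≡-Reasoning
      d : ℕ
      d = y / γ ∸ x / γ
      y≡x+dγ : y ≡ x + d * γ
      y≡x+dγ = %≡⇒≡+* γ x≤y same-residue
      d≡0 : d ≡ 0
      d≡0 = window-injective x (/≡⇒∸< M same-run) (trans (cong window (sym y≡x+dγ)) (sym same-window))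

    label-< : ∀ {s x} → x < s * γ * M → label x < s * γ * M
    label-< {s} {x} x<sγM = m<n⇒o<p⇒m*p+o<n*p (m<n⇒o<p⇒m*p+o<n*p run<s (m%n<n x γ)) (m%n<n _ M)
      where
      reorder : ∀ s γ M → s * γ * M ≡ s * M * γ
      reorder = solve-∀
      run<s : x / γ / M < s
      run<s = m<n*o⇒m/o<n (m<n*o⇒m/o<n (subst (x <_) (reorder s γ M) x<sγM))

    S≤fewLarge : ∀ n s → S p α n (s * γ * M) ≤ s * γ * fewLarge q t n
    S≤fewLarge n s = begin
      S p α n B               ≡⟨ length-filter-upTo (λ x → largeCount p (α ^ x) <? n) B ⟩
      count few B             ≤⟨ count-injection B few fewLow label maps (λ x<y _ _ _ → <⇒≢ x<y ∘ label-injective (<⇒≤ x<y)) ⟩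
      count fewLow B          ≡⟨ ∑-periodic (s * γ) M (λ v → χ (lowLarge p t v <ᵇ n)) ⟩
      s * γ * fewLarge q t n  ∎
      where
      open ≤-Reasoning
      B : ℕ
      B = s * γ * M
      few fewLow : ℕ → Bool
      few x = largeCount p (α ^ x) <ᵇ n
      fewLow c = lowLarge p t (c % M) <ᵇ n
      1<p : 1 < p
      1<p = nonTrivial⇒n>1 p ⦃ prime⇒nonTrivial prime ⦄
      maps : ∀ {x} → x < B → T (few x) → label x < B × T (fewLow (label x))
      maps {x} x<B few-x = label-< {s} x<B , <⇒<ᵇ (begin-strict
        lowLarge p t (label x % M)        ≡⟨ cong (lowLarge p t) ([m*n+o]%n≡o (orbit x) (m%n<n _ M)) ⟩
        lowLarge p t (window x)           ≡⟨ lowLarge-% p t (α ^ x / E) ⟩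
        lowLarge p t (α ^ x / E)          ≤⟨ lowLarge-/ p (suc e) t (α ^ x) ⟩
        lowLarge p (suc e + t) (α ^ x)    ≤⟨ lowLarge≤largeCount p 1<p (suc e + t) (α ^ x) ⟩
        largeCount p (α ^ x)              <⟨ <ᵇ⇒< _ n few-x ⟩
        n                                 ∎)

  S≤2t^[n∸1]l^t : ∀ {α γ} ⦃ _ : NonZero γ ⦄ → 1 < α → ¬ p ∣ α → α ^ γ % p ≡ 1 →
    ∀ n s t → S p α n (s * γ * p ^ suc t) ≤ 2 * s * γ * suc t ^ (n ∸ 1) * suc q ^ suc t
  S≤2t^[n∸1]l^t {α} {γ} 1<α p∤α αᵞ%p≡1 n s t with %p≡1⇒≡1+p^[1+e]*u prime (1<m⇒1<m^n 1<α) αᵞ%p≡1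
  ... | e , u , αᵞ≡ , p∤u = begin
    S p α n (s * γ * p ^ suc t)                             ≤⟨ S≤fewLarge {e = e} p∤α p∤u αᵞ≡ (suc t) n s ⟩
    s * γ * fewLarge q (suc t) n                            ≤⟨ *-monoʳ-≤ (s * γ) (fewLarge≤ q (suc t) n) ⟩
    s * γ * (suc q ^ suc t * binomSum (suc t) n)            ≤⟨ *-monoʳ-≤ (s * γ) (*-monoʳ-≤ (suc q ^ suc t) (binomSum≤ t n)) ⟩
    s * γ * (suc q ^ suc t * (2 * suc t ^ (n ∸ 1)))         ≡⟨ regroup s γ (suc q ^ suc t) (suc t ^ (n ∸ 1)) ⟩
    2 * s * γ * suc t ^ (n ∸ 1) * suc q ^ suc t             ∎
    where
    open ≤-Reasoning
    regroup : ∀ s γ L T → s * γ * (L * (2 * T)) ≡ 2 * s * γ * T * L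
    regroup = solve-∀

odd⇒≡1+2* : ∀ {p} → p % 2 ≡ 1 → ∃[ q ] p ≡ 1 + 2 * q
odd⇒≡1+2* {p} p%2≡1 = p / 2 , trans (m≡m%n+[m/n]*n p 2) (cong₂ _+_ p%2≡1 (*-comm (p / 2) 2))

[1+2q+1]/2≡1+q : ∀ q → (1 + 2 * q + 1) / 2 ≡ 1 + q
[1+2q+1]/2≡1+q q = trans (cong (_/ 2) (double q)) (m*n/n≡m (1 + q) 2)
  where
  double : ∀ q → 1 + 2 * q + 1 ≡ (1 + q) * 2
  double = solve-∀

lemma2p15 : (p α γ n : ℕ) → ⦃ _ : NonZero p ⦄ → Prime p → p % 2 ≡ 1 →
    1 < α → Coprime α p → IsOrd p α γ →
    (s t : ℕ) → 1 ≤ t →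
    S p α n (s * γ * p ^ t) ≤ 2 * s * γ * t ^ (n ∸ 1) * ((p + 1) / 2) ^ t
-- Only α ^ γ ≡ 1 (mod p) is used, not the minimality of γ.
lemma2p15 p α γ n p-prime p-odd 1<α α⊥p (0<γ , αᵞ≡1 , _) s (suc t) _ with odd⇒≡1+2* {p} p-odd
... | q , refl rewrite [1+2q+1]/2≡1+q q =
  S≤2t^[n∸1]l^t p-prime ⦃ >-nonZero 0<γ ⦄ 1<α p∤α (trans αᵞ≡1 (m<n⇒m%n≡m 1<p)) n s t
  where
  1<p : 1 < p
  1<p = nonTrivial⇒n>1 p ⦃ prime⇒nonTrivial p-prime ⦄
  p∤α : ¬ p ∣ α
  p∤α p∣α = nonTrivial⇒≢1 ⦃ prime⇒nonTrivial p-prime ⦄ (α⊥p (p∣α , ∣-refl))
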